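{- For any positive integer $i$ and any integer $j\ge 2^i$, let $C_{j,i}$ be the graph obtained from a cycle of length $j$ by replacing each edge with $i$ parallel edges, and let $M=M(C_{j,i})$ be its cycle matroid. Then the c$^*$d-depth of $M$ is at least $i$.
   Context: The cycle matroid $M(G)$ of a graph $G$ has ground set $E(G)$, and a set of edges is independent iff it is acyclic. A component of a matroid is an inclusion-wise maximal set of elements any two of which lie in a common circuit; $M$ is connected if it has one component. $M'$ is a c$^*$-transformation of $M$ if there are a matroid $M^+$ and $f\in E(M^+)$ with $M=M^+\setminus f$ and $M'=M^+/f$. The c$^*$d-depth of $M$ is: $1$ if $|E(M)|\le1$; the maximum c$^*$d-depth of the restrictions of $M$ to its components if $M$ is not connected; and if $M$ is connected, $1+$ the minimum c$^*$d-depth of a matroid $M'\ne M$ that is either $M\setminus e$ for some $e\in E(M)$ or a c$^*$-transformation of $M$. -}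

module Defs where

open import Level using (Level; 0ℓ) renaming (suc to lsuc)
open import Data.Nat using (ℕ; zero; suc; _≤_; _<_; _*_)
open import Data.Fin using (Fin; zero; suc; _≟_; remQuot)
open import Data.Fin.Subset using (Subset; inside; outside; ⊥; ⁅_⁆; _∈_; _∉_; _⊆_; _⊂_; _∪_; ∣_∣)
open import Data.Bool using (Bool; true; false; _∧_; _∨_)
open import Data.Vec using (Vec; tabulate; lookup; insertAt)
open import Data.Product using (Σ; ∃; _×_; _,_; proj₁)
open import Data.Sum using (_⊎_)
open import Relation.Nullary using (¬_)
open import Relation.Nullary.Decidable using (⌊_⌋)
open import Relation.Binary.PropositionalEquality using (_≡_)
open import Function.Definitions using (Injective)

Indep : ℕ → Set₁
Indep n = Subset n → Set

record IsMatroid {n : ℕ} (I : Indep n) : Set where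
  field
    empty-indep : I ⊥
    down-closed : ∀ X Y → Y ⊆ X → I X → I Y
    augment     : ∀ X Y → I X → I Y → ∣ X ∣ < ∣ Y ∣ →
                  ∃ λ e → e ∈ Y × e ∉ X × I (X ∪ ⁅ e ⁆)

SameM : ∀ {n} → Indep n → Indep n → Set
SameM I J = ∀ X → (I X → J X) × (J X → I X)

Circuit : ∀ {n} → Indep n → Subset n → Set
Circuit I C = ¬ I C × (∀ D → D ⊂ C → I D)

Related : ∀ {n} → Indep n → Fin n → Fin n → Set
Related I x y = x ≡ y ⊎ (∃ λ C → Circuit I C × x ∈ C × y ∈ C)

Pairwise : ∀ {n} → Indep n → Subset n → Set
Pairwise I C = ∀ x y → x ∈ C → y ∈ C → Related I x y

Component : ∀ {n} → Indep n → Subset n → Set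
Component I C = Pairwise I C × (∀ D → C ⊆ D → Pairwise I D → D ≡ C)

Connected : ∀ {n} → Indep n → Set
Connected I = ∃ λ C → Component I C × (∀ D → Component I D → D ≡ C)

-- M \ e : ground set Fin n, elements re-indexed by skipping e
delete : ∀ {n} → Indep (suc n) → Fin (suc n) → Indep n
delete I e Y = I (insertAt Y e outside)

-- M / f : if f is a loop, M / f = M \ f; otherwise Y is independent iff Y ∪ {f} is
contract : ∀ {n} → Indep (suc n) → Fin (suc n) → Indep n
contract I f Y = (I ⁅ f ⁆ → I (insertAt Y f inside))
               × (¬ I ⁅ f ⁆ → I (insertAt Y f outside))

anyFin : ∀ {m} → (Fin m → Bool) → Bool
anyFin {zero}  p = false
anyFin {suc m} p = p zero ∨ anyFin (λ y → p (suc y))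

image : ∀ {m n} → (Fin m → Fin n) → Subset m → Subset n
image ι Y = tabulate (λ x → anyFin (λ y → lookup Y y ∧ ⌊ ι y ≟ x ⌋))

-- restriction of I to the image of an injective relabelling ι : Fin m → Fin n
restrict : ∀ {m n} → Indep n → (Fin m → Fin n) → Indep m
restrict I ι Y = I (image ι Y)

CStar : ∀ {n} → Indep n → Indep n → Set₁
CStar {n} I J = Σ (Indep (suc n)) λ P → IsMatroid P ×
                  (∃ λ f → SameM I (delete P f) × SameM J (contract P f))

-- c*d-depth.  DepthLE n I k  means  "c*d-depth of I is at most k"
-- (least fixed point of the recursive definition).

data DepthLE : (n : ℕ) → Indep n → ℕ → Set₁ where
  small : ∀ {n I k} → n ≤ 1 → 1 ≤ k → DepthLE n I k
  disc  : ∀ {n I k} → 2 ≤ n → ¬ Connected I →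
          (∀ C → Component I C → ∀ m (ι : Fin m → Fin n) → Injective _≡_ _≡_ ι →
             (∀ x → (x ∈ C → ∃ λ y → ι y ≡ x) × ((∃ λ y → ι y ≡ x) → x ∈ C)) →
             DepthLE m (restrict I ι) k) →
          DepthLE n I k
  del   : ∀ {n I k} → 2 ≤ suc n → Connected I → (e : Fin (suc n)) →
          DepthLE n (delete I e) k → DepthLE (suc n) I (suc k)
  cstar : ∀ {n I k} → 2 ≤ n → Connected I → (J : Indep n) → CStar I J →
          ¬ SameM I J → DepthLE n J k → DepthLE n I (suc k)

-- cyclic successor on Fin k
rot : ∀ {k} → Fin (suc k) → Fin (suc k)
rot {zero}  zero    = zero
rot {suc k} zero    = suc zero
rot {suc k} (suc t) with rot {k} t
... | zero  = zero
... | suc u = suc (suc u)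

next : ∀ {k} → Fin k → Fin k
next {suc k} t = rot t

-- a multigraph with vertex set Fin v and edge set Fin n, edge e joins ends e
-- A cycle contained in the edge set X: distinct edges e₀…e_k, distinct vertices
-- v₀…v_k, edge e_t joining v_t and v_{t+1 mod (k+1)}.
Joins : ∀ {v} → Fin v × Fin v → Fin v → Fin v → Set
Joins (a , b) x y = ((a ≡ x) × (b ≡ y)) ⊎ ((a ≡ y) × (b ≡ x))

record CycleIn {v n : ℕ} (ends : Fin n → Fin v × Fin v) (X : Subset n) : Set where
  field
    k       : ℕ
    edge    : Fin (suc k) → Fin n
    vert    : Fin (suc k) → Fin v
    edge-inj : Injective _≡_ _≡_ edge
    vert-inj : Injective _≡_ _≡_ vert
    edge-in  : ∀ t → edge t ∈ X
    joins    : ∀ t → Joins (ends (edge t)) (vert t) (vert (next t))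

cycleMatroid : ∀ {v n} → (Fin n → Fin v × Fin v) → Indep n
cycleMatroid ends X = ¬ CycleIn ends X

-- C_{j,i}: cycle on vertices Fin j, each edge a→a+1 replaced by i parallel edges;
-- edge (a , b) with b : Fin i encoded in Fin (j * i) via remQuot/combine.
Cji-ends : (j i : ℕ) → Fin (j * i) → Fin j × Fin j
Cji-ends j i e = let a = proj₁ (remQuot i e) in (a , next a)

{-# OPTIONS --safe #-}
-- The cycle matroid of C_{j,i} contains a grid with j rows and i columns: the i parallel
-- edges between two consecutive vertices form a row, and every transversal is a Hamiltonian
-- circuit. By induction on the derivation of "depth ≤ k", a matroid containing a grid with at
-- least 2^d rows and at least d columns has depth at least d. A component contains the whole
-- grid, and deleting an element costs at most one column. In a c*-transformation
-- M = M⁺ \ f, M′ = M⁺ / f the element f is not a loop of M⁺ (else M′ = M); call a set K of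
-- rows tight if a transversal over K together with f is a circuit of M⁺. By parallel exchange
-- tightness does not depend on the transversal, by circuit elimination two tight sets cover
-- all rows, and a tight set is a grid of M⁺ / f; so M′ keeps all columns and half the rows.
-- The classical steps (minimal and maximal sets) are justified because the goal d ≤ k is
-- decidable and every predicate on the subsets of a finite set is ¬¬-decidable.
module Submission where

open import Defs
open import Data.Nat as ℕ using (ℕ; zero; suc; _+_; _^_; _*_; _≤_; _<_; z≤n; s≤s; _≤?_)
import Data.Nat.Properties as ℕ
open import Data.Bool using (Bool; true; false; T)
open import Data.Bool.Properties using (T-≡; T-∧; T-∨)
open import Data.Fin using (Fin; zero; suc; punchIn; punchOut; _≟_; combine; remQuot; inject₁; fromℕ; toℕ)
open import Data.Fin.Properties
  using ( 0≢1+n; suc-injective; toℕ-inject₁; ≤fromℕ; remQuot-combine; combine-injective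
        ; any?; all?; ¬∀⟶∃¬; punchIn-injective; punchInᵢ≢i; punchIn-punchOut )
open import Data.Fin.Subset
open import Data.Fin.Subset.Properties
open import Data.Fin.Induction using (<-weakInduction; <-weakInduction-startingFrom)
open import Data.Fin.Subset.Induction using (⊂-wellFounded; ⊃-wellFounded; Acc; acc)
open import Data.Vec using (_∷_; []; lookup; tabulate; insertAt; here; there)
open import Data.Vec.Functional using (updateAt; tail) renaming (_∷_ to _∷ᶠ_)
open import Data.Vec.Functional.Properties using (updateAt-updates; updateAt-minimal)
open import Data.Vec.Properties
  using (lookup∘tabulate; insertAt-lookup; insertAt-punchIn; []=⇒lookup; lookup⇒[]=)
open import Data.Product using (Σ; ∃; _×_; _,_; proj₁; proj₂; swap)
open import Data.Sum using (_⊎_; inj₁; inj₂; [_,_]′)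
import Data.Sum as Sum
open import Function using (_∘_; id)
open import Function.Definitions using (Injective)
open import Function.Bundles using (Equivalence)
open import Relation.Nullary using (¬_; Dec; yes; no; contradiction)
open import Relation.Nullary.Negation using (¬¬-Monad; ¬¬-map)
open import Effect.Monad using (RawMonad)
open import Relation.Nullary.Decidable
  using (⌊_⌋; decidable-stable; ¬¬-excluded-middle; _×-dec_; ¬?; toWitness; fromWitness)
open import Relation.Unary using (Decidable)
open import Relation.Binary.PropositionalEquality
  using (_≡_; _≢_; _≗_; refl; sym; trans; cong; cong₂; subst; module ≡-Reasoning)

private
  variable
    n m : ℕ

∣p∪q∣≤∣p∣+∣q∣ : ∀ (p q : Subset n) → ∣ p ∪ q ∣ ≤ ∣ p ∣ + ∣ q ∣
∣p∪q∣≤∣p∣+∣q∣ []          []          = z≤n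
∣p∪q∣≤∣p∣+∣q∣ (true ∷ p)  (true ∷ q)  =
  s≤s (ℕ.≤-trans (∣p∪q∣≤∣p∣+∣q∣ p q) (ℕ.+-monoʳ-≤ ∣ p ∣ (ℕ.n≤1+n _)))
∣p∪q∣≤∣p∣+∣q∣ (true ∷ p)  (false ∷ q) = s≤s (∣p∪q∣≤∣p∣+∣q∣ p q)
∣p∪q∣≤∣p∣+∣q∣ (false ∷ p) (true ∷ q)  =
  subst (suc ∣ p ∪ q ∣ ≤_) (sym (ℕ.+-suc ∣ p ∣ ∣ q ∣)) (s≤s (∣p∪q∣≤∣p∣+∣q∣ p q))
∣p∪q∣≤∣p∣+∣q∣ (false ∷ p) (false ∷ q) = ∣p∪q∣≤∣p∣+∣q∣ p q

x∉p-x : ∀ (p : Subset n) x → x ∉ p - x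
x∉p-x (_ ∷ p) zero    ()
x∉p-x (_ ∷ p) (suc x) (there x∈) = x∉p-x p x x∈

∣p∪⁅x⁆∣≤1+∣p∣ : ∀ (p : Subset n) x → ∣ p ∪ ⁅ x ⁆ ∣ ≤ suc ∣ p ∣
∣p∪⁅x⁆∣≤1+∣p∣ p x = begin
  ∣ p ∪ ⁅ x ⁆ ∣     ≤⟨ ∣p∪q∣≤∣p∣+∣q∣ p ⁅ x ⁆ ⟩
  ∣ p ∣ + ∣ ⁅ x ⁆ ∣ ≡⟨ cong (∣ p ∣ +_) (∣⁅x⁆∣≡1 x) ⟩
  ∣ p ∣ + 1         ≡⟨ ℕ.+-comm ∣ p ∣ 1 ⟩
  suc ∣ p ∣         ∎
  where open ℕ.≤-Reasoning

p⊆p-x∪⁅x⁆ : ∀ (p : Subset n) x → p ⊆ (p - x) ∪ ⁅ x ⁆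
p⊆p-x∪⁅x⁆ p x {y} y∈p with y ≟ x
... | yes refl = x∈p∪q⁺ (inj₂ (x∈⁅x⁆ x))
... | no  y≢x  = x∈p∪q⁺ (inj₁ (x∈p∧x≢y⇒x∈p-y y∈p y≢x))

∣p∣≤1+∣p-x∣ : ∀ (p : Subset n) x → ∣ p ∣ ≤ suc ∣ p - x ∣
∣p∣≤1+∣p-x∣ p x =
  ℕ.≤-trans (p⊆q⇒∣p∣≤∣q∣ (p⊆p-x∪⁅x⁆ p x)) (∣p∪⁅x⁆∣≤1+∣p∣ (p - x) x)

∣p-x∪⁅y⁆∣≤∣p∣ : ∀ {p : Subset n} {x} y → x ∈ p → ∣ (p - x) ∪ ⁅ y ⁆ ∣ ≤ ∣ p ∣
∣p-x∪⁅y⁆∣≤∣p∣ {p = p} {x} y x∈p =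
  ℕ.≤-trans (∣p∪⁅x⁆∣≤1+∣p∣ (p - x) y) (x∈p⇒∣p-x∣<∣p∣ x∈p)

p⊂p∪⁅x⁆ : ∀ {p : Subset n} {x} → x ∉ p → p ⊂ p ∪ ⁅ x ⁆
p⊂p∪⁅x⁆ {p = p} {x} x∉p = p⊆p∪q ⁅ x ⁆ , x , q⊆p∪q p ⁅ x ⁆ (x∈⁅x⁆ x) , x∉p

p⊆q∧∣q∣≤∣p∣⇒q⊆p : ∀ {p q : Subset n} → p ⊆ q → ∣ q ∣ ≤ ∣ p ∣ → q ⊆ p
p⊆q∧∣q∣≤∣p∣⇒q⊆p {p = p} p⊆q ∣q∣≤∣p∣ {x} x∈q with x ∈? p
... | yes x∈p = x∈p
... | no  x∉p = contradiction ∣q∣≤∣p∣ (ℕ.<⇒≱ (p⊂q⇒∣p∣<∣q∣ (p⊆q , x , x∈q , x∉p)))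

p⊆q∧∣q∣≤1+∣p∣⇒q-x⊆p : ∀ {p q : Subset n} {x} →
                       p ⊆ q → x ∈ q → x ∉ p → ∣ q ∣ ≤ suc ∣ p ∣ → q - x ⊆ p
p⊆q∧∣q∣≤1+∣p∣⇒q-x⊆p {p = p} {q} {x} p⊆q x∈q x∉p ∣q∣≤1+∣p∣ =
  p⊆q∧∣q∣≤∣p∣⇒q⊆p p⊆q-x (ℕ.≤-pred (ℕ.≤-trans (x∈p⇒∣p-x∣<∣p∣ x∈q) ∣q∣≤1+∣p∣))
  where
  p⊆q-x : p ⊆ q - x
  p⊆q-x {y} y∈p = x∈p∧x≢y⇒x∈p-y (p⊆q y∈p) λ { refl → x∉p y∈p }

∪-lub : ∀ {p q r : Subset n} → p ⊆ r → q ⊆ r → p ∪ q ⊆ r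
∪-lub {p = p} {q} p⊆r q⊆r x∈p∪q with x∈p∪q⁻ p q x∈p∪q
... | inj₁ x∈p = p⊆r x∈p
... | inj₂ x∈q = q⊆r x∈q

x∈p⇒⁅x⁆⊆p : ∀ {p : Subset n} {x} → x ∈ p → ⁅ x ⁆ ⊆ p
x∈p⇒⁅x⁆⊆p {x = x} x∈p y∈⁅x⁆ = subst (_∈ _) (sym (x∈⁅y⁆⇒x≡y x y∈⁅x⁆)) x∈p

p⊆⁅x⁆∪q∧x∉p⇒p⊆q : ∀ {p q : Subset n} {x} → p ⊆ ⁅ x ⁆ ∪ q → x ∉ p → p ⊆ q
p⊆⁅x⁆∪q∧x∉p⇒p⊆q {p = p} {q} {x} p⊆ x∉p v∈p with x∈p∪q⁻ ⁅ x ⁆ q (p⊆ v∈p)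
... | inj₁ v∈⁅x⁆ = contradiction (subst (_∈ p) (x∈⁅y⁆⇒x≡y x v∈⁅x⁆) v∈p) x∉p
... | inj₂ v∈q   = v∈q

p⊂⁅x⁆∪⁅y⁆⇒p⊆⁅x⁆⊎p⊆⁅y⁆ : ∀ {p : Subset n} {x y} →
                          p ⊂ ⁅ x ⁆ ∪ ⁅ y ⁆ → p ⊆ ⁅ x ⁆ ⊎ p ⊆ ⁅ y ⁆
p⊂⁅x⁆∪⁅y⁆⇒p⊆⁅x⁆⊎p⊆⁅y⁆ {p = p} {x} {y} (p⊆ , z , z∈ , z∉p) with x∈p∪q⁻ ⁅ x ⁆ ⁅ y ⁆ z∈
... | inj₁ z∈⁅x⁆ = inj₂ (p⊆⁅x⁆∪q∧x∉p⇒p⊆q p⊆ (subst (_∉ p) (x∈⁅y⁆⇒x≡y x z∈⁅x⁆) z∉p))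
... | inj₂ z∈⁅y⁆ = inj₁ (p⊆⁅x⁆∪q∧x∉p⇒p⊆q (⊆-trans p⊆ (⊆-reflexive (∪-comm ⁅ x ⁆ ⁅ y ⁆)))
                                          (subst (_∉ p) (x∈⁅y⁆⇒x≡y y z∈⁅y⁆) z∉p))

p⊆q⇒p-x⊆q-x : ∀ {p q : Subset n} {x} → p ⊆ q → p - x ⊆ q - x
p⊆q⇒p-x⊆q-x {p = p} {x = x} p⊆q y∈ =
  x∈p∧x≢y⇒x∈p-y (p⊆q (p─q⊆p p ⁅ x ⁆ y∈)) λ { refl → x∉p-x p x y∈ }

⁅x⁆⊂⁅x⁆∪⁅y⁆ : ∀ {x y : Fin n} → x ≢ y → ⁅ x ⁆ ⊂ ⁅ x ⁆ ∪ ⁅ y ⁆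
⁅x⁆⊂⁅x⁆∪⁅y⁆ {x = x} {y} x≢y =
  p⊆p∪q ⁅ y ⁆ , y , q⊆p∪q ⁅ x ⁆ ⁅ y ⁆ (x∈⁅x⁆ y) , λ y∈⁅x⁆ → x≢y (sym (x∈⁅y⁆⇒x≡y x y∈⁅x⁆))

∣p∣>0⇒Nonempty : ∀ (p : Subset n) → 0 < ∣ p ∣ → Nonempty p
∣p∣>0⇒Nonempty (true  ∷ p) _   = zero , here
∣p∣>0⇒Nonempty (false ∷ p) pos = let x , x∈p = ∣p∣>0⇒Nonempty p pos in suc x , there x∈p

∣p∣≥2⇒∃≢ : ∀ {p : Subset n} → 2 ≤ ∣ p ∣ → ∀ x → ∃ λ y → y ∈ p × y ≢ x
∣p∣≥2⇒∃≢ {p = p} ∣p∣≥2 x =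
  let y , y∈p-x = ∣p∣>0⇒Nonempty (p - x) (ℕ.≤-pred (ℕ.≤-trans ∣p∣≥2 (∣p∣≤1+∣p-x∣ p x)))
  in y , p─q⊆p p ⁅ x ⁆ y∈p-x , λ y≡x → x∉p-x p x (subst (_∈ p - x) y≡x y∈p-x)

⊤⊆p∪q⇒≤∣p∣⊎≤∣q∣ : ∀ {p q : Subset n} {m} →
                   (∀ x → x ∈ p ∪ q) → 2 * m ≤ n → m ≤ ∣ p ∣ ⊎ m ≤ ∣ q ∣
⊤⊆p∪q⇒≤∣p∣⊎≤∣q∣ {n} {p} {q} {m} ⊤⊆p∪q 2m≤n with m ≤? ∣ p ∣ | m ≤? ∣ q ∣
... | yes m≤∣p∣ | _         = inj₁ m≤∣p∣
... | no  _     | yes m≤∣q∣ = inj₂ m≤∣q∣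
... | no  m≰∣p∣ | no  m≰∣q∣ = contradiction 2m≤n (ℕ.<⇒≱ (begin-strict
  n                 ≡⟨ ∣⊤∣≡n n ⟨
  ∣ ⊤ {n} ∣         ≤⟨ p⊆q⇒∣p∣≤∣q∣ {p = ⊤} (λ {x} _ → ⊤⊆p∪q x) ⟩
  ∣ p ∪ q ∣         ≤⟨ ∣p∪q∣≤∣p∣+∣q∣ p q ⟩
  ∣ p ∣ + ∣ q ∣     <⟨ ℕ.+-mono-< (ℕ.≰⇒> m≰∣p∣) (ℕ.≰⇒> m≰∣q∣) ⟩
  m + m             ≡⟨ cong (m +_) (ℕ.+-identityʳ m) ⟨
  2 * m             ∎))
  where open ℕ.≤-Reasoning

∈⇒T : ∀ {p : Subset n} {x} → x ∈ p → T (lookup p x)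
∈⇒T x∈p = Equivalence.from T-≡ ([]=⇒lookup x∈p)

T⇒∈ : ∀ {p : Subset n} {x} → T (lookup p x) → x ∈ p
T⇒∈ {p = p} {x} px = lookup⇒[]= x p (Equivalence.to T-≡ px)

x∈tabulate⁺ : ∀ {g : Fin n → Bool} {x} → T (g x) → x ∈ tabulate g
x∈tabulate⁺ {g = g} {x} gx = T⇒∈ (subst T (sym (lookup∘tabulate g x)) gx)

x∈tabulate⁻ : ∀ {g : Fin n → Bool} {x} → x ∈ tabulate g → T (g x)
x∈tabulate⁻ {g = g} {x} x∈ = subst T (lookup∘tabulate g x) (∈⇒T x∈)

anyFin⁺ : ∀ (p : Fin m → Bool) y → T (p y) → T (anyFin p)
anyFin⁺ p zero    py = Equivalence.from T-∨ (inj₁ py)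
anyFin⁺ p (suc y) py = Equivalence.from T-∨ (inj₂ (anyFin⁺ (p ∘ suc) y py))

anyFin⁻ : ∀ (p : Fin m → Bool) → T (anyFin p) → ∃ λ y → T (p y)
anyFin⁻ {suc m} p h with Equivalence.to T-∨ h
... | inj₁ p0 = zero , p0
... | inj₂ ps = let y , py = anyFin⁻ (p ∘ suc) ps in suc y , py

x∈image⁺ : ∀ (ι : Fin m → Fin n) {Y y x} → y ∈ Y → ι y ≡ x → x ∈ image ι Y
x∈image⁺ ι {y = y} y∈Y refl =
  x∈tabulate⁺ (anyFin⁺ _ y (Equivalence.from T-∧ (∈⇒T y∈Y , fromWitness refl)))

x∈image⁻ : ∀ (ι : Fin m → Fin n) Y {x} → x ∈ image ι Y → ∃ λ y → y ∈ Y × ι y ≡ x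
x∈image⁻ ι Y x∈ with anyFin⁻ _ (x∈tabulate⁻ x∈)
... | y , h with Equivalence.to T-∧ h
... | y∈Y , ιy≡x = y , T⇒∈ y∈Y , toWitness ιy≡x

image-mono : ∀ (F : Fin m → Fin n) {p q} → p ⊆ q → image F p ⊆ image F q
image-mono F {p} p⊆q x∈ = let y , y∈p , Fy≡x = x∈image⁻ F p x∈ in x∈image⁺ F (p⊆q y∈p) Fy≡x

image-cong : ∀ {g h : Fin m → Fin n} {K} → (∀ {t} → t ∈ K → g t ≡ h t) → image g K ≡ image h K
image-cong {g = g} {h} {K} g≡h = ⊆-antisym
  (λ x∈ → let t , t∈K , gt≡x = x∈image⁻ g K x∈ in x∈image⁺ h t∈K (trans (sym (g≡h t∈K)) gt≡x))
  (λ x∈ → let t , t∈K , ht≡x = x∈image⁻ h K x∈ in x∈image⁺ g t∈K (trans (g≡h t∈K) ht≡x))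

image-∘ : ∀ {l} (F : Fin m → Fin n) {g : Fin l → Fin m} {h} K →
          (∀ {t} → t ∈ K → F (g t) ≡ h t) → image F (image g K) ≡ image h K
image-∘ F {g} {h} K Fg≡h = ⊆-antisym
  (λ x∈ → let y , y∈ , Fy≡x = x∈image⁻ F (image g K) x∈ ; t , t∈K , gt≡y = x∈image⁻ g K y∈ in
          x∈image⁺ h t∈K (trans (sym (Fg≡h t∈K)) (trans (cong F gt≡y) Fy≡x)))
  (λ x∈ → let t , t∈K , ht≡x = x∈image⁻ h K x∈ in
          x∈image⁺ F (x∈image⁺ g t∈K refl) (trans (Fg≡h t∈K) ht≡x))

image-⁅⁆ : ∀ {F : Fin m → Fin n} y → image F ⁅ y ⁆ ≡ ⁅ F y ⁆
image-⁅⁆ {F = F} y = ⊆-antisym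
  (λ x∈ → let z , z∈ , Fz≡x = x∈image⁻ F ⁅ y ⁆ x∈ in
          subst (_∈ ⁅ F y ⁆) (trans (cong F (sym (x∈⁅y⁆⇒x≡y y z∈))) Fz≡x) (x∈⁅x⁆ (F y)))
  (λ x∈ → x∈image⁺ F (x∈⁅x⁆ y) (sym (x∈⁅y⁆⇒x≡y (F y) x∈)))

image-∪ : ∀ {F : Fin m → Fin n} p q → image F (p ∪ q) ≡ image F p ∪ image F q
image-∪ {F = F} p q = ⊆-antisym
  (λ x∈ → let y , y∈ , Fy≡x = x∈image⁻ F (p ∪ q) x∈ in
          x∈p∪q⁺ (Sum.map (λ y∈p → x∈image⁺ F y∈p Fy≡x) (λ y∈q → x∈image⁺ F y∈q Fy≡x)
                          (x∈p∪q⁻ p q y∈)))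
  (∪-lub (image-mono F (p⊆p∪q {p = p} q)) (image-mono F (q⊆p∪q p q)))

image-pair : ∀ (F : Fin m → Fin n) x y → image F (⁅ x ⁆ ∪ ⁅ y ⁆) ≡ ⁅ F x ⁆ ∪ ⁅ F y ⁆
image-pair F x y = trans (image-∪ ⁅ x ⁆ ⁅ y ⁆) (cong₂ _∪_ (image-⁅⁆ x) (image-⁅⁆ y))

x∈insertAt⁻ : ∀ (Y : Subset n) e {b x} → x ∈ insertAt Y e b →
              (x ≡ e × b ≡ inside) ⊎ ∃ λ y → y ∈ Y × punchIn e y ≡ x
x∈insertAt⁻ Y e {b} {x} x∈ with e ≟ x
... | yes refl = inj₁ (refl , trans (sym (insertAt-lookup Y e b)) ([]=⇒lookup x∈))
... | no  e≢x  = inj₂ (punchOut e≢x , lookup⇒[]= _ Y lookup≡inside , punchIn-punchOut e≢x)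
  where
  open ≡-Reasoning
  lookup≡inside : lookup Y (punchOut e≢x) ≡ inside
  lookup≡inside = begin
    lookup Y (punchOut e≢x)                            ≡⟨ insertAt-punchIn Y e b _ ⟨
    lookup (insertAt Y e b) (punchIn e (punchOut e≢x)) ≡⟨ cong (lookup (insertAt Y e b)) (punchIn-punchOut e≢x) ⟩
    lookup (insertAt Y e b) x                          ≡⟨ []=⇒lookup x∈ ⟩
    inside                                             ∎

punchIn∈insertAt : ∀ {Y : Subset n} {y} e b → y ∈ Y → punchIn e y ∈ insertAt Y e b
punchIn∈insertAt {Y = Y} {y} e b y∈Y =
  lookup⇒[]= _ _ (trans (insertAt-punchIn Y e b y) ([]=⇒lookup y∈Y))

insertAt-outside : ∀ (Y : Subset n) e → insertAt Y e outside ≡ image (punchIn e) Y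
insertAt-outside Y e = ⊆-antisym forth back
  where
  forth : insertAt Y e outside ⊆ image (punchIn e) Y
  forth x∈ with x∈insertAt⁻ Y e x∈
  ... | inj₂ (y , y∈Y , eq) = x∈image⁺ (punchIn e) y∈Y eq
  back : image (punchIn e) Y ⊆ insertAt Y e outside
  back x∈ = let y , y∈Y , eq = x∈image⁻ (punchIn e) Y x∈ in
            subst (_∈ _) eq (punchIn∈insertAt e outside y∈Y)

insertAt-inside : ∀ (Y : Subset n) e → insertAt Y e inside ≡ image (punchIn e) Y ∪ ⁅ e ⁆
insertAt-inside Y e = ⊆-antisym forth (∪-lub back (x∈p⇒⁅x⁆⊆p e∈))
  where
  e∈ : e ∈ insertAt Y e inside
  e∈ = lookup⇒[]= e _ (insertAt-lookup Y e inside)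
  forth : insertAt Y e inside ⊆ image (punchIn e) Y ∪ ⁅ e ⁆
  forth x∈ with x∈insertAt⁻ Y e x∈
  ... | inj₁ (refl , _)     = x∈p∪q⁺ (inj₂ (x∈⁅x⁆ e))
  ... | inj₂ (y , y∈Y , eq) = x∈p∪q⁺ (inj₁ (x∈image⁺ (punchIn e) y∈Y eq))
  back : image (punchIn e) Y ⊆ insertAt Y e inside
  back x∈ = let y , y∈Y , eq = x∈image⁻ (punchIn e) Y x∈ in
            subst (_∈ _) eq (punchIn∈insertAt e inside y∈Y)

preimage : (Fin m → Fin n) → Subset n → Subset m
preimage F D = tabulate (λ y → lookup D (F y))

y∈preimage⁺ : ∀ {F : Fin m → Fin n} {D y} → F y ∈ D → y ∈ preimage F D
y∈preimage⁺ Fy∈D = x∈tabulate⁺ (∈⇒T Fy∈D)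

y∈preimage⁻ : ∀ {F : Fin m → Fin n} {D y} → y ∈ preimage F D → F y ∈ D
y∈preimage⁻ y∈ = T⇒∈ (x∈tabulate⁻ y∈)

image-preimage : ∀ (F : Fin m → Fin n) {D Y} → D ⊆ image F Y → image F (preimage F D) ≡ D
image-preimage F {D} {Y} D⊆FY = ⊆-antisym
  (λ x∈ → let y , y∈ , Fy≡x = x∈image⁻ F (preimage F D) x∈ in
          subst (_∈ D) Fy≡x (y∈preimage⁻ y∈))
  (λ x∈D → let y , _ , Fy≡x = x∈image⁻ F Y (D⊆FY x∈D) in
           x∈image⁺ F (y∈preimage⁺ (subst (_∈ D) (sym Fy≡x) x∈D)) Fy≡x)

module _ {F : Fin m → Fin n} (F-injective : Injective _≡_ _≡_ F) where

  image-⊂ : ∀ {D Y} → D ⊂ Y → image F D ⊂ image F Y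
  image-⊂ {D} (D⊆Y , y , y∈Y , y∉D) = image-mono F D⊆Y , F y , x∈image⁺ F y∈Y refl , Fy∉FD
    where
    Fy∉FD : F y ∉ image F D
    Fy∉FD Fy∈ = let z , z∈D , Fz≡Fy = x∈image⁻ F D Fy∈ in
                y∉D (subst (_∈ D) (F-injective Fz≡Fy) z∈D)

  preimage-⊂ : ∀ {D Y} → D ⊂ image F Y → preimage F D ⊂ Y
  preimage-⊂ {D} {Y} (D⊆FY , x , x∈FY , x∉D) with x∈image⁻ F Y x∈FY
  ... | y , y∈Y , refl = preimage⊆Y , y , y∈Y , x∉D ∘ y∈preimage⁻
    where
    preimage⊆Y : preimage F D ⊆ Y
    preimage⊆Y z∈ = let z′ , z′∈Y , Fz′≡Fz = x∈image⁻ F Y (D⊆FY (y∈preimage⁻ z∈)) in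
      subst (_∈ Y) (F-injective Fz′≡Fz) z′∈Y

punchIn-injective′ : ∀ (e : Fin (suc n)) → Injective _≡_ _≡_ (punchIn e)
punchIn-injective′ e {x} {y} = punchIn-injective e x y

enumerate : ∀ (p : Subset n) → Fin ∣ p ∣ → Fin n
enumerate (true  ∷ p) zero    = zero
enumerate (true  ∷ p) (suc u) = suc (enumerate p u)
enumerate (false ∷ p) u       = suc (enumerate p u)

enumerate-∈ : ∀ (p : Subset n) u → enumerate p u ∈ p
enumerate-∈ (true  ∷ p) zero    = here
enumerate-∈ (true  ∷ p) (suc u) = there (enumerate-∈ p u)
enumerate-∈ (false ∷ p) u       = there (enumerate-∈ p u)

enumerate-injective : ∀ (p : Subset n) → Injective _≡_ _≡_ (enumerate p)
enumerate-injective (true  ∷ p) {zero}  {zero}  _  = refl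
enumerate-injective (true  ∷ p) {suc u} {suc v} eq = cong suc (enumerate-injective p (suc-injective eq))
enumerate-injective (false ∷ p)                 eq = enumerate-injective p (suc-injective eq)

position : ∀ {p : Subset n} {x} → x ∈ p → Fin ∣ p ∣
position {p = true  ∷ _} here       = zero
position {p = true  ∷ _} (there x∈) = suc (position x∈)
position {p = false ∷ _} (there x∈) = position x∈

enumerate-position : ∀ {p : Subset n} {x} (x∈p : x ∈ p) → enumerate p (position x∈p) ≡ x
enumerate-position {p = true  ∷ _} here       = refl
enumerate-position {p = true  ∷ _} (there x∈) = cong suc (enumerate-position x∈)
enumerate-position {p = false ∷ _} (there x∈) = cong suc (enumerate-position x∈)

enumerate-range : ∀ (C : Subset n) x →
                  (x ∈ C → ∃ λ u → enumerate C u ≡ x) × ((∃ λ u → enumerate C u ≡ x) → x ∈ C)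
enumerate-range C x =
  (λ x∈C → position x∈C , enumerate-position x∈C) , λ { (u , refl) → enumerate-∈ C u }

image-enumerate : ∀ (K : Subset m) {g : Fin m → Fin n} {h : Fin ∣ K ∣ → Fin n} →
                  (∀ u → g (enumerate K u) ≡ h u) → image h ⊤ ≡ image g K
image-enumerate K {g} {h} g∘enumerate≡h = ⊆-antisym
  (λ x∈ → let u , _ , hu≡x = x∈image⁻ h ⊤ x∈ in
          x∈image⁺ g (enumerate-∈ K u) (trans (g∘enumerate≡h u) hu≡x))
  (λ x∈ → let t , t∈K , gt≡x = x∈image⁻ g K x∈ in
          x∈image⁺ h ∈⊤
            (trans (sym (g∘enumerate≡h _)) (trans (cong g (enumerate-position t∈K)) gt≡x)))

-- Classical reasoning about the subsets of a finite set

¬¬-decidable : ∀ (Q : Subset n → Set) → ¬ ¬ Decidable Q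
¬¬-decidable {zero}  Q = ¬¬-map (λ { Q[]? [] → Q[]? }) ¬¬-excluded-middle
¬¬-decidable {suc n} Q = do
  Q-in?  ← ¬¬-decidable (λ X → Q (inside ∷ X))
  Q-out? ← ¬¬-decidable (λ X → Q (outside ∷ X))
  pure λ { (true ∷ X) → Q-in? X ; (false ∷ X) → Q-out? X }
  where open RawMonad ¬¬-Monad

assuming-decidable : ∀ {B : Set} → Dec B → (Q : Subset n → Set) → (Decidable Q → B) → B
assuming-decidable B? Q prove = decidable-stable B? (¬¬-map prove (¬¬-decidable Q))

module _ {Q : Subset n → Set} (Q? : Decidable Q) where

  minimal-⊆ : ∀ {U} → Q U → ∃ λ C → C ⊆ U × Q C × (∀ {x} → x ∈ C → ¬ Q (C - x))
  minimal-⊆ = go (⊂-wellFounded _)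
    where
    go : ∀ {U} → Acc _⊂_ U → Q U → ∃ λ C → C ⊆ U × Q C × (∀ {x} → x ∈ C → ¬ Q (C - x))
    go {U} (acc smaller) QU with any? (λ x → x ∈? U ×-dec Q? (U - x))
    ... | yes (x , x∈U , QU-x) = let C , C⊆U-x , QC , minimal = go (smaller (x∈p⇒p-x⊂p x∈U)) QU-x in
                                 C , ⊆-trans C⊆U-x (p─q⊆p U ⁅ x ⁆) , QC , minimal
    ... | no  none             = U , ⊆-refl , QU , λ x∈U QU-x → none (_ , x∈U , QU-x)

  maximal-⊇ : ∀ {U} → Q U → ∃ λ C → U ⊆ C × Q C × (∀ x → Q (C ∪ ⁅ x ⁆) → x ∈ C)
  maximal-⊇ = go (⊃-wellFounded _)
    where
    go : ∀ {U} → Acc _⊃_ U → Q U → ∃ λ C → U ⊆ C × Q C × (∀ x → Q (C ∪ ⁅ x ⁆) → x ∈ C)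
    go {U} (acc larger) QU with any? (λ x → ¬? (x ∈? U) ×-dec Q? (U ∪ ⁅ x ⁆))
    ... | yes (x , x∉U , QU+x) = let C , U+x⊆C , QC , maximal = go (larger (p⊂p∪⁅x⁆ x∉U)) QU+x in
                                 C , ⊆-trans (p⊆p∪q ⁅ x ⁆) U+x⊆C , QC , maximal
    ... | no  none             =
      U , ⊆-refl , QU , λ x QU+x → decidable-stable (x ∈? U) (λ x∉U → none (x , x∉U , QU+x))

-- Matroids and their restrictions

module MatroidProperties {P : Indep n} (isMatroid : IsMatroid P) where
  open IsMatroid isMatroid

  indep-⊆ : ∀ {X Y} → Y ⊆ X → P X → P Y
  indep-⊆ {X} {Y} = down-closed X Y

  augment-to : ∀ {X Y} → P X → P Y → ∃ λ Z → P Z × X ⊆ Z × Z ⊆ X ∪ Y × ∣ Y ∣ ≤ ∣ Z ∣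
  augment-to = go (⊃-wellFounded _)
    where
    go : ∀ {X Y} → Acc _⊃_ X → P X → P Y → ∃ λ Z → P Z × X ⊆ Z × Z ⊆ X ∪ Y × ∣ Y ∣ ≤ ∣ Z ∣
    go {X} {Y} (acc larger) PX PY with ∣ Y ∣ ≤? ∣ X ∣
    ... | yes ∣Y∣≤∣X∣ = X , PX , ⊆-refl , p⊆p∪q Y , ∣Y∣≤∣X∣
    ... | no  ∣Y∣≰∣X∣ with augment X Y PX PY (ℕ.≰⇒> ∣Y∣≰∣X∣)
    ... | e , e∈Y , e∉X , PX+e with go (larger (p⊂p∪⁅x⁆ e∉X)) PX+e PY
    ... | Z , PZ , X+e⊆Z , Z⊆X+e∪Y , ∣Y∣≤∣Z∣ =
      Z , PZ , ⊆-trans (p⊆p∪q ⁅ e ⁆) X+e⊆Z , ⊆-trans Z⊆X+e∪Y X+e∪Y⊆X∪Y , ∣Y∣≤∣Z∣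
      where
      X+e∪Y⊆X∪Y : (X ∪ ⁅ e ⁆) ∪ Y ⊆ X ∪ Y
      X+e∪Y⊆X∪Y = ∪-lub (∪-lub (p⊆p∪q Y) (x∈p⇒⁅x⁆⊆p (q⊆p∪q X Y e∈Y))) (q⊆p∪q X Y)

  parallel-exchange : ∀ {W x y} → ¬ P (⁅ x ⁆ ∪ ⁅ y ⁆) → P ⁅ x ⁆ → y ∈ W → P W →
                      P ((W - y) ∪ ⁅ x ⁆)
  parallel-exchange {W} {x} {y} ¬Pxy Px y∈W PW with augment-to Px PW
  ... | Z , PZ , x⊆Z , Z⊆x∪W , ∣W∣≤∣Z∣ =
    indep-⊆ (p⊆q∧∣q∣≤∣p∣⇒q⊆p Z⊆W′ (ℕ.≤-trans (∣p-x∪⁅y⁆∣≤∣p∣ x y∈W) ∣W∣≤∣Z∣)) PZ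
    where
    y∉Z : y ∉ Z
    y∉Z y∈Z = ¬Pxy (indep-⊆ (∪-lub x⊆Z (x∈p⇒⁅x⁆⊆p y∈Z)) PZ)
    Z⊆W′ : Z ⊆ (W - y) ∪ ⁅ x ⁆
    Z⊆W′ z∈Z with x∈p∪q⁻ ⁅ x ⁆ W (Z⊆x∪W z∈Z)
    ... | inj₁ z∈⁅x⁆ = q⊆p∪q (W - y) ⁅ x ⁆ z∈⁅x⁆
    ... | inj₂ z∈W   = p⊆p∪q ⁅ x ⁆ (x∈p∧x≢y⇒x∈p-y z∈W λ { refl → y∉Z z∈Z })

  -- Extend C₁ - a within (C₁ ∪ C₂) - e: the extension contains a, hence C₁, or else it
  -- misses only a from C₁ ∪ C₂ and so contains C₂.
  weak-circuit-elimination : ∀ {C₁ C₂ a} e →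
                             ¬ P C₁ → a ∈ C₁ → P (C₁ - a) → ¬ P C₂ → a ∉ C₂ → ¬ P ((C₁ ∪ C₂) - e)
  weak-circuit-elimination {C₁} {C₂} {a} e ¬PC₁ a∈C₁ PC₁-a ¬PC₂ a∉C₂ PU-e
    with augment-to PC₁-a PU-e
  ... | Z , PZ , C₁-a⊆Z , Z⊆ , ∣U-e∣≤∣Z∣ with a ∈? Z
  ...   | yes a∈Z = ¬PC₁ (indep-⊆ C₁⊆Z PZ)
    where
    C₁⊆Z : C₁ ⊆ Z
    C₁⊆Z {c} c∈C₁ with c ≟ a
    ... | yes refl = a∈Z
    ... | no  c≢a  = C₁-a⊆Z (x∈p∧x≢y⇒x∈p-y c∈C₁ c≢a)
  ...   | no  a∉Z = ¬PC₂ (indep-⊆ C₂⊆Z PZ)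
    where
    U : Subset n
    U = C₁ ∪ C₂
    Z⊆U : Z ⊆ U
    Z⊆U = ⊆-trans Z⊆ (∪-lub (⊆-trans (p─q⊆p C₁ _) (p⊆p∪q C₂)) (p─q⊆p U _))
    U-a⊆Z : U - a ⊆ Z
    U-a⊆Z = p⊆q∧∣q∣≤1+∣p∣⇒q-x⊆p Z⊆U (p⊆p∪q C₂ a∈C₁) a∉Z (ℕ.≤-trans (∣p∣≤1+∣p-x∣ U e) (s≤s ∣U-e∣≤∣Z∣))
    C₂⊆Z : C₂ ⊆ Z
    C₂⊆Z c∈C₂ = U-a⊆Z (x∈p∧x≢y⇒x∈p-y (q⊆p∪q C₁ C₂ c∈C₂) λ { refl → a∉C₂ c∈C₂ })

SameM-trans : ∀ {I J K : Indep n} → SameM I J → SameM J K → SameM I K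
SameM-trans I≈J J≈K Y = proj₁ (J≈K Y) ∘ proj₁ (I≈J Y) , proj₂ (I≈J Y) ∘ proj₂ (J≈K Y)

SameM-sym : ∀ {I J : Indep n} → SameM I J → SameM J I
SameM-sym I≈J Y = swap (I≈J Y)

delete≈restrict : ∀ (M : Indep (suc n)) e → SameM (delete M e) (restrict M (punchIn e))
delete≈restrict M e Y = subst M (insertAt-outside Y e) , subst M (sym (insertAt-outside Y e))

contract≈restrict : ∀ {P : Indep (suc n)} f → P ⁅ f ⁆ →
                    SameM (contract P f) (restrict (λ X → P (X ∪ ⁅ f ⁆)) (punchIn f))
contract≈restrict {P = P} f Pf Y =
  (λ P/fY → subst P (insertAt-inside Y f) (proj₁ P/fY Pf)) ,
  (λ PY+f → (λ _ → subst P (sym (insertAt-inside Y f)) PY+f) , λ ¬Pf → contradiction Pf ¬Pf)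

delete≈contract : ∀ {P : Indep (suc n)} {f} → ¬ P ⁅ f ⁆ → SameM (delete P f) (contract P f)
delete≈contract ¬Pf Y =
  (λ P\fY → (λ Pf → contradiction Pf ¬Pf) , λ _ → P\fY) , λ P/fY → proj₂ P/fY ¬Pf

Circuit-SameM : ∀ {I J : Indep n} → SameM I J → ∀ {Y} → Circuit I Y → Circuit J Y
Circuit-SameM I≈J {Y} (¬IY , I⊂Y) = ¬IY ∘ proj₂ (I≈J Y) , λ D D⊂Y → proj₁ (I≈J D) (I⊂Y D D⊂Y)

module _ {F : Fin m → Fin n} (F-injective : Injective _≡_ _≡_ F) {M : Indep n} where

  Circuit-restrict⁻ : ∀ {Y} → Circuit M (image F Y) → Circuit (restrict M F) Y
  Circuit-restrict⁻ (¬MFY , M⊂FY) = ¬MFY , λ D D⊂Y → M⊂FY (image F D) (image-⊂ F-injective D⊂Y)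

  Circuit-restrict⁺ : ∀ {Y} → Circuit (restrict M F) Y → Circuit M (image F Y)
  Circuit-restrict⁺ {Y} (¬MFY , M⊂Y) = ¬MFY , λ D D⊂FY →
    subst M (image-preimage F {Y = Y} (proj₁ D⊂FY)) (M⊂Y (preimage F D) (preimage-⊂ F-injective D⊂FY))

-- Grids

transversal : ∀ {L a} → (Fin L → Fin a → Fin n) → (Fin L → Fin a) → Subset L → Subset n
transversal cell σ K = image (λ t → cell t (σ t)) K

record Grid (M : Indep n) (L a : ℕ) : Set where
  field
    cell                : Fin L → Fin a → Fin n
    cell-injective      : ∀ {t t′ s s′} → cell t s ≡ cell t′ s′ → t ≡ t′ × s ≡ s′
    row-circuit         : ∀ t {s s′} → s ≢ s′ → Circuit M (⁅ cell t s ⁆ ∪ ⁅ cell t s′ ⁆)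
    transversal-circuit : ∀ σ → Circuit M (transversal cell σ ⊤)

module _ {L a : ℕ} where

  Grid-SameM : ∀ {M M′ : Indep n} → SameM M M′ → Grid M L a → Grid M′ L a
  Grid-SameM M≈M′ G = record
    { cell                = cell
    ; cell-injective      = cell-injective
    ; row-circuit         = λ t s≢s′ → Circuit-SameM M≈M′ (row-circuit t s≢s′)
    ; transversal-circuit = λ σ → Circuit-SameM M≈M′ (transversal-circuit σ)
    }
    where open Grid G

  module _ {F : Fin m → Fin n} (F-injective : Injective _≡_ _≡_ F) {M : Indep n} where

    Grid-pullback : (G : Grid M L a) → (∀ t s → ∃ λ y → F y ≡ Grid.cell G t s) →
                    Grid (restrict M F) L a
    Grid-pullback G lift = record
      { cell                = cell′
      ; cell-injective      = λ eq →
          cell-injective (trans (sym (F∘cell′ _ _)) (trans (cong F eq) (F∘cell′ _ _)))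
      ; row-circuit         = λ t {s} {s′} s≢s′ → Circuit-restrict⁻ F-injective
          (subst (Circuit M) (sym (image-pair′ t s s′)) (row-circuit t s≢s′))
      ; transversal-circuit = λ σ → Circuit-restrict⁻ F-injective
          (subst (Circuit M) (sym (image-∘ F ⊤ (λ {t} _ → F∘cell′ t (σ t)))) (transversal-circuit σ))
      }
      where
      open Grid G
      cell′ : Fin L → Fin a → Fin m
      cell′ t s = proj₁ (lift t s)
      F∘cell′ : ∀ t s → F (cell′ t s) ≡ cell t s
      F∘cell′ t s = proj₂ (lift t s)
      image-pair′ : ∀ t s s′ → image F (⁅ cell′ t s ⁆ ∪ ⁅ cell′ t s′ ⁆) ≡ ⁅ cell t s ⁆ ∪ ⁅ cell t s′ ⁆
      image-pair′ t s s′ =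
        trans (image-pair F _ _) (cong₂ (λ x y → ⁅ x ⁆ ∪ ⁅ y ⁆) (F∘cell′ t s) (F∘cell′ t s′))

    Grid-pushforward : Grid (restrict M F) L a → Grid M L a
    Grid-pushforward G = record
      { cell                = λ t s → F (cell t s)
      ; cell-injective      = cell-injective ∘ F-injective
      ; row-circuit         = λ t s≢s′ →
          subst (Circuit M) (image-pair F _ _) (Circuit-restrict⁺ F-injective (row-circuit t s≢s′))
      ; transversal-circuit = λ σ →
          subst (Circuit M) (image-∘ F {g = λ t → cell t (σ t)} ⊤ (λ _ → refl))
                (Circuit-restrict⁺ F-injective (transversal-circuit σ))
      }
      where open Grid G

  Grid-dropColumn : ∀ {M : Indep n} → Grid M L (suc a) → Fin (suc a) → Grid M L a
  Grid-dropColumn G c = record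
    { cell                = λ t s → cell t (punchIn c s)
    ; cell-injective      = λ eq →
        let t≡t′ , s≡s′ = cell-injective eq in t≡t′ , punchIn-injective c _ _ s≡s′
    ; row-circuit         = λ t s≢s′ → row-circuit t (s≢s′ ∘ punchIn-injective c _ _)
    ; transversal-circuit = λ σ → transversal-circuit (punchIn c ∘ σ)
    }
    where open Grid G

  Grid-avoiding : ∀ {M : Indep n} → Grid M L (suc a) → (e : Fin n) →
                  Σ (Grid M L a) λ G′ → ∀ t s → Grid.cell G′ t s ≢ e
  Grid-avoiding G e with any? (λ t → any? (λ s → Grid.cell G t s ≟ e))
  ... | yes (t₀ , s₀ , cell≡e) = Grid-dropColumn G s₀ , λ t s eq →
          punchInᵢ≢i s₀ s (proj₂ (Grid.cell-injective G (trans eq (sym cell≡e))))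
  ... | no  e∉G                = Grid-dropColumn G zero , λ t s eq → e∉G (t , punchIn zero s , eq)

  cells : ∀ {M : Indep n} → Grid M L a → Subset n
  cells G = tabulate (λ x → ⌊ any? (λ t → any? (λ s → Grid.cell G t s ≟ x)) ⌋)

  module _ {M : Indep n} (G : Grid M L a) where
    open Grid G

    cell∈cells : ∀ t s → cell t s ∈ cells G
    cell∈cells t s = x∈tabulate⁺ (fromWitness (t , s , refl))

    cells-pairwise : Pairwise M (cells G)
    cells-pairwise x y x∈ y∈ with toWitness (x∈tabulate⁻ x∈) | toWitness (x∈tabulate⁻ y∈)
    ... | t , s , refl | t′ , s′ , refl with t ≟ t′
    ... | no t≢t′ = inj₂ (transversal cell σ ⊤ , transversal-circuit σ ,
                          x∈image⁺ cellσ ∈⊤ (cong (cell t) σt≡s) ,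
                          x∈image⁺ cellσ ∈⊤ (cong (cell t′) σt′≡s′))
      where
      σ : Fin L → Fin a
      σ = updateAt (λ _ → s′) t (λ _ → s)
      σt≡s : σ t ≡ s
      σt≡s = updateAt-updates t (λ _ → s′)
      σt′≡s′ : σ t′ ≡ s′
      σt′≡s′ = updateAt-minimal t′ t (λ _ → s′) (t≢t′ ∘ sym)
      cellσ : Fin L → Fin n
      cellσ u = cell u (σ u)
    ... | yes refl with s ≟ s′
    ...   | yes refl = inj₁ refl
    ...   | no  s≢s′ =
      inj₂ (_ , row-circuit t s≢s′ , x∈p∪q⁺ (inj₁ (x∈⁅x⁆ _)) , x∈p∪q⁺ (inj₂ (x∈⁅x⁆ _)))

  module _ {M : Indep n} (K : Subset L) (cell : Fin L → Fin (suc a) → Fin n)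
           (cell-injective : ∀ {t t′ s s′} → cell t s ≡ cell t′ s′ → t ≡ t′ × s ≡ s′)
           (row-circuit : ∀ {t} → t ∈ K → ∀ {s s′} → s ≢ s′ →
                          Circuit M (⁅ cell t s ⁆ ∪ ⁅ cell t s′ ⁆))
           (transversal-circuit : ∀ σ → Circuit M (transversal cell σ K)) where

    Grid-onRows : Grid M ∣ K ∣ (suc a)
    Grid-onRows = record
      { cell                = cell ∘ enumerate K
      ; cell-injective      = λ eq →
          let t≡t′ , s≡s′ = cell-injective eq in enumerate-injective K t≡t′ , s≡s′
      ; row-circuit         = λ u → row-circuit (enumerate-∈ K u)
      ; transversal-circuit = λ τ → subst (Circuit M)
          (sym (image-enumerate K (λ u → cong (cell (enumerate K u)) (extend-enumerate τ u))))
          (transversal-circuit (extend τ))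
      }
      where
      -- the value of extend τ off K is irrelevant
      extend : (Fin ∣ K ∣ → Fin (suc a)) → Fin L → Fin (suc a)
      extend τ t with t ∈? K
      ... | yes t∈K = τ (position t∈K)
      ... | no  _   = zero
      extend-enumerate : ∀ τ u → extend τ (enumerate K u) ≡ τ u
      extend-enumerate τ u with enumerate K u ∈? K
      ... | yes t∈K = cong τ (enumerate-injective K (enumerate-position t∈K))
      ... | no  t∉K = contradiction (enumerate-∈ K u) t∉K

Pairwise-⊆ : ∀ {I : Indep n} {C D} → D ⊆ C → Pairwise I C → Pairwise I D
Pairwise-⊆ D⊆C pairwise x y x∈D y∈D = pairwise x y (D⊆C x∈D) (D⊆C y∈D)

component-⊇ : ∀ {I : Indep n} → Decidable (Pairwise I) → ∀ {U} → Pairwise I U →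
              ∃ λ C → U ⊆ C × Component I C
component-⊇ pairwise? pairwiseU with maximal-⊇ pairwise? pairwiseU
... | C , U⊆C , pairwiseC , maximal = C , U⊆C , pairwiseC , λ D C⊆D pairwiseD →
  ⊆-antisym (λ {x} x∈D → maximal x (Pairwise-⊆ (∪-lub C⊆D (x∈p⇒⁅x⁆⊆p x∈D)) pairwiseD)) C⊆D

Grid-inComponent : ∀ {I : Indep n} {L a} → Decidable (Pairwise I) → Grid I L a →
                   ∃ λ C → Component I C × Grid (restrict I (enumerate C)) L a
Grid-inComponent pairwise? G with component-⊇ pairwise? (cells-pairwise G)
... | C , cells⊆C , C-component = C , C-component ,
  Grid-pullback (enumerate-injective C) G λ t s → _ , enumerate-position (cells⊆C (cell∈cells G t s))

Grid-delete : ∀ {I : Indep (suc n)} {L a} → Grid I L (suc a) → ∀ e → Grid (delete I e) L a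
Grid-delete {I = I} G e with Grid-avoiding G e
... | G′ , avoid = Grid-SameM (SameM-sym (delete≈restrict I e))
  (Grid-pullback (punchIn-injective′ e) G′ λ t s → punchOut (avoid t s ∘ sym) , punchIn-punchOut _)

-- Contracting a non-loop outside a grid

module _ {A : Set} where

  AgreeOff : ∀ {L} → Fin L → (Fin L → A) → (Fin L → A) → Set
  AgreeOff t σ τ = ∀ u → u ≢ t → σ u ≡ τ u

  transport-by-single-changes : ∀ {L} (Q : (Fin L → A) → Set) →
    (∀ {σ τ} → σ ≗ τ → Q σ → Q τ) → (∀ {σ τ} t → AgreeOff t σ τ → Q σ → Q τ) →
    ∀ σ τ → Q σ → Q τ
  transport-by-single-changes {zero}  Q Q-≗ Q-change σ τ = Q-≗ λ ()
  transport-by-single-changes {suc L} Q Q-≗ Q-change σ τ =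
    Q-≗ τ₀∷tailτ≗τ ∘ transport-by-single-changes Q′ Q′-≗ Q′-change (tail σ) (tail τ)
                   ∘ Q-change zero σ≈τ₀∷tailσ
    where
    Q′ : (Fin L → A) → Set
    Q′ ρ = Q (τ zero ∷ᶠ ρ)
    ∷-≗ : ∀ {ρ ρ′} → ρ ≗ ρ′ → (τ zero ∷ᶠ ρ) ≗ (τ zero ∷ᶠ ρ′)
    ∷-≗ ρ≗ρ′ zero    = refl
    ∷-≗ ρ≗ρ′ (suc u) = ρ≗ρ′ u
    Q′-≗ : ∀ {ρ ρ′} → ρ ≗ ρ′ → Q′ ρ → Q′ ρ′
    Q′-≗ = Q-≗ ∘ ∷-≗
    Q′-change : ∀ {ρ ρ′} t → AgreeOff t ρ ρ′ → Q′ ρ → Q′ ρ′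
    Q′-change t agree = Q-change (suc t) λ { zero _ → refl ; (suc u) u≢t → agree u (u≢t ∘ cong suc) }
    σ≈τ₀∷tailσ : AgreeOff zero σ (τ zero ∷ᶠ tail σ)
    σ≈τ₀∷tailσ zero    0≢0 = contradiction refl 0≢0
    σ≈τ₀∷tailσ (suc u) _   = refl
    τ₀∷tailτ≗τ : (τ zero ∷ᶠ tail τ) ≗ τ
    τ₀∷tailτ≗τ zero    = refl
    τ₀∷tailτ≗τ (suc u) = refl

module NonLoopContraction {P : Indep (suc n)} (isMatroid : IsMatroid P) (P? : Decidable P)
                          (f : Fin (suc n)) (Pf : P ⁅ f ⁆)
                          {L a} (G : Grid P L (suc a)) (f∉G : ∀ t s → Grid.cell G t s ≢ f) where
  open Grid G
  open MatroidProperties isMatroid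

  Choice : Set
  Choice = Fin L → Fin (suc a)

  E : Choice → Subset L → Subset (suc n)
  E σ K = transversal cell σ K ∪ ⁅ f ⁆

  -- For K ≠ ⊤ this says that E σ K is a circuit.
  Tight : Choice → Subset L → Set
  Tight σ K = ¬ P (E σ K) × (∀ {t} → t ∈ K → P (E σ (K - t)))

  cell-injectiveˡ : ∀ {σ : Choice} {t t′} → cell t (σ t) ≡ cell t′ (σ t′) → t ≡ t′
  cell-injectiveˡ = proj₁ ∘ cell-injective

  f∈E : ∀ σ K → f ∈ E σ K
  f∈E σ K = q⊆p∪q (transversal cell σ K) ⁅ f ⁆ (x∈⁅x⁆ f)

  cell∈E : ∀ σ {K t} → t ∈ K → cell t (σ t) ∈ E σ K
  cell∈E σ t∈K = p⊆p∪q ⁅ f ⁆ (x∈image⁺ (λ t → cell t (σ t)) t∈K refl)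

  x∈E⁻ : ∀ σ K {x} → x ∈ E σ K → x ≡ f ⊎ ∃ λ t → t ∈ K × cell t (σ t) ≡ x
  x∈E⁻ σ K x∈ with x∈p∪q⁻ (transversal cell σ K) ⁅ f ⁆ x∈
  ... | inj₁ x∈T   = inj₂ (x∈image⁻ (λ t → cell t (σ t)) K x∈T)
  ... | inj₂ x∈⁅f⁆ = inj₁ (x∈⁅y⁆⇒x≡y f x∈⁅f⁆)

  cell∈E⇒∈ : ∀ σ K {t} → cell t (σ t) ∈ E σ K → t ∈ K
  cell∈E⇒∈ σ K {t} c∈ with x∈E⁻ σ K c∈
  ... | inj₁ c≡f              = contradiction c≡f (f∉G t _)
  ... | inj₂ (u , u∈K , c≡c′) = subst (_∈ _) (cell-injectiveˡ c≡c′) u∈K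

  E-mono : ∀ σ {K K′} → K ⊆ K′ → E σ K ⊆ E σ K′
  E-mono σ K⊆K′ =
    ∪-lub (⊆-trans (image-mono (λ t → cell t (σ t)) K⊆K′) (p⊆p∪q ⁅ f ⁆)) (q⊆p∪q _ ⁅ f ⁆)

  E-cong : ∀ {σ τ} K → (∀ {t} → t ∈ K → σ t ≡ τ t) → E σ K ≡ E τ K
  E-cong K σ≡τ = cong (_∪ ⁅ f ⁆) (image-cong λ t∈K → cong (cell _) (σ≡τ t∈K))

  E-f⊆transversal : ∀ σ K → E σ K - f ⊆ transversal cell σ K
  E-f⊆transversal σ K x∈ with x∈E⁻ σ K (p─q⊆p (E σ K) ⁅ f ⁆ x∈)
  ... | inj₁ refl              = contradiction x∈ (x∉p-x (E σ K) f)
  ... | inj₂ (t , t∈K , c≡x)   = x∈image⁺ (λ t → cell t (σ t)) t∈K c≡x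

  E-cell⊆E : ∀ σ K t → E σ K - cell t (σ t) ⊆ E σ (K - t)
  E-cell⊆E σ K t x∈ with x∈E⁻ σ K (p─q⊆p (E σ K) _ x∈)
  ... | inj₁ refl             = f∈E σ (K - t)
  ... | inj₂ (u , u∈K , refl) = cell∈E σ (x∈p∧x≢y⇒x∈p-y u∈K λ { refl → x∉p-x (E σ K) _ x∈ })

  transversal-dependent : ∀ σ → ¬ P (transversal cell σ ⊤)
  transversal-dependent σ = proj₁ (transversal-circuit σ)

  transversal-independent : ∀ σ {K t} → t ∉ K → P (transversal cell σ K)
  transversal-independent σ {t = t} t∉K = proj₂ (transversal-circuit σ) _
    (image-⊂ cell-injectiveˡ (⊆⊤ , t , ∈⊤ , t∉K))

  exchange-row : ∀ {σ τ K} t → AgreeOff t σ τ → P (E σ K) → P (E τ K)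
  exchange-row {σ} {τ} {K} t agree PEσ with t ∈? K | σ t ≟ τ t
  ... | no t∉K | _          = subst P (E-cong K λ {u} u∈K → agree u λ { refl → t∉K u∈K }) PEσ
  ... | yes _  | yes σt≡τt  = subst P (E-cong K λ {u} _ → agree-everywhere u) PEσ
    where
    agree-everywhere : ∀ u → σ u ≡ τ u
    agree-everywhere u with u ≟ t
    ... | yes refl = σt≡τt
    ... | no  u≢t  = agree u u≢t
  ... | yes t∈K | no σt≢τt = indep-⊆ Eτ⊆ (parallel-exchange (proj₁ pair) Px (cell∈E σ t∈K) PEσ)
    where
    pair : Circuit P (⁅ cell t (τ t) ⁆ ∪ ⁅ cell t (σ t) ⁆)
    pair = row-circuit t (σt≢τt ∘ sym)
    Px : P ⁅ cell t (τ t) ⁆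
    Px = proj₂ pair _ (⁅x⁆⊂⁅x⁆∪⁅y⁆ (σt≢τt ∘ sym ∘ proj₂ ∘ cell-injective))
    Eτ⊆ : E τ K ⊆ (E σ K - cell t (σ t)) ∪ ⁅ cell t (τ t) ⁆
    Eτ⊆ x∈ with x∈E⁻ τ K x∈
    ... | inj₁ refl = p⊆p∪q _ (x∈p∧x≢y⇒x∈p-y (f∈E σ K) (f∉G t (σ t) ∘ sym))
    ... | inj₂ (u , u∈K , refl) with u ≟ t
    ...   | yes refl = q⊆p∪q _ _ (x∈⁅x⁆ _)
    ...   | no  u≢t  = p⊆p∪q _ (x∈p∧x≢y⇒x∈p-y
      (subst (_∈ E σ K) (cong (cell u) (agree u u≢t)) (cell∈E σ u∈K))
      (u≢t ∘ cell-injectiveˡ ∘ trans (cong (cell u) (agree u u≢t))))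

  Tight-≗ : ∀ {σ τ} K → σ ≗ τ → Tight σ K → Tight τ K
  Tight-≗ K σ≗τ (¬PE , PE-t) =
    subst (¬_ ∘ P) (E-cong K λ {t} _ → σ≗τ t) ¬PE ,
    λ {t} t∈K → subst P (E-cong (K - t) λ {u} _ → σ≗τ u) (PE-t t∈K)

  Tight-change : ∀ {σ τ} K t → AgreeOff t σ τ → Tight σ K → Tight τ K
  Tight-change K t agree (¬PEσ , PEσ-t) =
    ¬PEσ ∘ exchange-row {K = K} t (λ u u≢t → sym (agree u u≢t)) ,
    λ {t′} t′∈K → exchange-row {K = K - t′} t agree (PEσ-t t′∈K)

  Tight-any : ∀ {σ} τ {K} → Tight σ K → Tight τ K
  Tight-any {σ} τ {K} = transport-by-single-changes (λ σ → Tight σ K) (Tight-≗ K) (Tight-change K) σ τ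

  σ₀ : Choice
  σ₀ _ = zero

  dependent⇒tight-⊆ : ∀ {U} → ¬ P (E σ₀ U) → ∃ λ K → K ⊆ U × Tight σ₀ K
  dependent⇒tight-⊆ ¬PEU with minimal-⊆ (λ K → ¬? (P? (E σ₀ K))) ¬PEU
  ... | K , K⊆U , ¬PEK , minimal = K , K⊆U , ¬PEK , λ t∈K → decidable-stable (P? _) (minimal t∈K)

  f∉transversal : ∀ σ K → f ∉ transversal cell σ K
  f∉transversal σ K f∈ = let t , _ , c≡f = x∈image⁻ (λ t → cell t (σ t)) K f∈ in f∉G t (σ t) c≡f

  tight⇒nonempty : ∀ {σ K} → Tight σ K → Nonempty K
  tight⇒nonempty {σ} {K} (¬PE , _) with nonempty? K
  ... | yes K≠∅ = K≠∅
  ... | no  K=∅ = contradiction (indep-⊆ E⊆⁅f⁆ Pf) ¬PE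
    where
    E⊆⁅f⁆ : E σ K ⊆ ⁅ f ⁆
    E⊆⁅f⁆ x∈ with x∈E⁻ σ K x∈
    ... | inj₁ refl           = x∈⁅x⁆ f
    ... | inj₂ (t , t∈K , _) = contradiction (t , t∈K) K=∅

  dependent⇒dependent-⊤-x : ∀ {K t₀} → ¬ P (E σ₀ K) → t₀ ∉ K → ∀ x → ¬ P (E σ₀ (⊤ - x))
  dependent⇒dependent-⊤-x {K} ¬PE t₀∉K x PE⊤-x =
    weak-circuit-elimination (cell x zero)
      ¬PE (f∈E σ₀ K) (indep-⊆ (E-f⊆transversal σ₀ K) (transversal-independent σ₀ t₀∉K))
      (transversal-dependent σ₀) (f∉transversal σ₀ ⊤)
      (indep-⊆ (E-cell⊆E σ₀ ⊤ x ∘ p⊆q⇒p-x⊆q-x (∪-lub (E-mono σ₀ {K} ⊆⊤) (p⊆p∪q ⁅ f ⁆))) PE⊤-x)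

  tight-∪-covers : ∀ {K₁ K₂ x} → Tight σ₀ K₁ → ¬ P (E σ₀ K₂) → x ∈ K₁ → x ∉ K₂ →
                   ∀ t → t ∈ K₁ ∪ K₂
  tight-∪-covers {K₁} {K₂} {x} (¬PE₁ , PE₁-t) ¬PE₂ x∈K₁ x∉K₂ t =
    decidable-stable (t ∈? K₁ ∪ K₂) λ t∉K₁∪K₂ →
      weak-circuit-elimination f
        ¬PE₁ (cell∈E σ₀ x∈K₁) (indep-⊆ (E-cell⊆E σ₀ K₁ x) (PE₁-t x∈K₁)) ¬PE₂ (x∉K₂ ∘ cell∈E⇒∈ σ₀ K₂)
        (indep-⊆ (E₁∪E₂-f⊆ t∉K₁∪K₂) (transversal-independent σ₀ (x∉p-x ⊤ t)))
    where
    E₁∪E₂-f⊆ : t ∉ K₁ ∪ K₂ → (E σ₀ K₁ ∪ E σ₀ K₂) - f ⊆ transversal cell σ₀ (⊤ - t)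
    E₁∪E₂-f⊆ t∉ = image-mono (λ u → cell u zero) K₁∪K₂⊆⊤-t
                ∘ E-f⊆transversal σ₀ (K₁ ∪ K₂)
                ∘ p⊆q⇒p-x⊆q-x (∪-lub (E-mono σ₀ (p⊆p∪q {p = K₁} K₂)) (E-mono σ₀ (q⊆p∪q K₁ K₂)))
      where
      K₁∪K₂⊆⊤-t : K₁ ∪ K₂ ⊆ ⊤ - t
      K₁∪K₂⊆⊤-t u∈ = x∈p∧x≢y⇒x∈p-y ∈⊤ λ { refl → t∉ u∈ }

  tight-cover : ∃ λ K₁ → ∃ λ K₂ → Tight σ₀ K₁ × Tight σ₀ K₂ × (∀ t → t ∈ K₁ ∪ K₂)
  tight-cover with dependent⇒tight-⊆ {⊤} (transversal-dependent σ₀ ∘ indep-⊆ (p⊆p∪q ⁅ f ⁆))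
  ... | K₁ , _ , tight₁ with all? (_∈? K₁) | tight⇒nonempty tight₁
  ...   | yes ⊤⊆K₁ | _            = K₁ , K₁ , tight₁ , tight₁ , λ t → p⊆p∪q K₁ (⊤⊆K₁ t)
  ...   | no  ⊤⊈K₁ | x , x∈K₁ with ¬∀⟶∃¬ L _ (_∈? K₁) ⊤⊈K₁
  ...     | _ , t₀∉K₁ with dependent⇒tight-⊆ (dependent⇒dependent-⊤-x (proj₁ tight₁) t₀∉K₁ x)
  ...       | K₂ , K₂⊆⊤-x , tight₂ =
    K₁ , K₂ , tight₁ , tight₂ , tight-∪-covers tight₁ (proj₁ tight₂) x∈K₁ (x∉p-x ⊤ x ∘ K₂⊆⊤-x)

  large-tight : ∀ d → 2 ^ suc d ≤ L → ∃ λ K → Tight σ₀ K × 2 ^ d ≤ ∣ K ∣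
  large-tight d 2^d+1≤L with tight-cover
  ... | K₁ , K₂ , tight₁ , tight₂ , cover with ⊤⊆p∪q⇒≤∣p∣⊎≤∣q∣ cover 2^d+1≤L
  ...   | inj₁ 2^d≤∣K₁∣ = K₁ , tight₁ , 2^d≤∣K₁∣
  ...   | inj₂ 2^d≤∣K₂∣ = K₂ , tight₂ , 2^d≤∣K₂∣

  contracted : Indep (suc n)
  contracted X = P (X ∪ ⁅ f ⁆)

  tight-grid : ∀ {K} → Tight σ₀ K → 2 ≤ ∣ K ∣ → Grid contracted ∣ K ∣ (suc a)
  tight-grid {K} tight 2≤∣K∣ = Grid-onRows K cell cell-injective row′ transversal′
    where
    tight-τ : ∀ τ → Tight τ K
    tight-τ τ = Tight-any τ tight
    transversal′ : ∀ τ → Circuit contracted (transversal cell τ K)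
    transversal′ τ = proj₁ (tight-τ τ) , minimal
      where
      cellτ : Fin L → Fin (suc n)
      cellτ t = cell t (τ t)
      minimal : ∀ D → D ⊂ transversal cell τ K → contracted D
      minimal D (D⊆ , y , y∈ , y∉D) with x∈image⁻ cellτ K y∈
      ... | t , t∈K , refl =
        indep-⊆ (∪-lub (⊆-trans D⊆T-t (p⊆p∪q ⁅ f ⁆)) (q⊆p∪q _ ⁅ f ⁆)) (proj₂ (tight-τ τ) t∈K)
        where
        D⊆T-t : D ⊆ transversal cell τ (K - t)
        D⊆T-t d∈D with x∈image⁻ cellτ K (D⊆ d∈D)
        ... | u , u∈K , refl = x∈image⁺ cellτ (x∈p∧x≢y⇒x∈p-y u∈K λ { refl → y∉D d∈D }) refl
    row′ : ∀ {t} → t ∈ K → ∀ {s s′} → s ≢ s′ → Circuit contracted (⁅ cell t s ⁆ ∪ ⁅ cell t s′ ⁆)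
    row′ {t} t∈K {s} {s′} s≢s′ = proj₁ (row-circuit t s≢s′) ∘ indep-⊆ (p⊆p∪q ⁅ f ⁆) , λ D D⊂ →
      [ single s , single s′ ]′ (p⊂⁅x⁆∪⁅y⁆⇒p⊆⁅x⁆⊎p⊆⁅y⁆ D⊂)
      where
      single : ∀ r {D} → D ⊆ ⁅ cell t r ⁆ → contracted D
      single r D⊆ with ∣p∣≥2⇒∃≢ 2≤∣K∣ t
      ... | t′ , t′∈K , t′≢t = indep-⊆ (∪-lub (⊆-trans D⊆ (x∈p⇒⁅x⁆⊆p cell∈E′)) (q⊆p∪q _ ⁅ f ⁆))
                                       (proj₂ (tight-τ (λ _ → r)) t′∈K)
        where
        cell∈E′ : cell t r ∈ E (λ _ → r) (K - t′)
        cell∈E′ = cell∈E (λ _ → r) (x∈p∧x≢y⇒x∈p-y t∈K (t′≢t ∘ sym))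

2≤2^suc : ∀ d → 2 ≤ 2 ^ suc d
2≤2^suc d = ℕ.*-monoʳ-≤ 2 (ℕ.m^n>0 2 d)

Grid-contract : ∀ {P : Indep (suc n)} {I J f L a} → IsMatroid P → Decidable P → P ⁅ f ⁆ →
              SameM I (delete P f) → SameM J (contract P f) → Grid I L (suc a) →
              ∀ d → 2 ^ suc (suc d) ≤ L → ∃ λ L′ → Grid J L′ (suc a) × 2 ^ suc d ≤ L′
Grid-contract {P = P} {J = J} {f = f} {L} {a} isMatroid P? Pf I≈P\f J≈P/f G d 2^d+2≤L =
  shrink (large-tight (suc d) 2^d+2≤L)
  where
  lifted : Grid P L (suc a)
  lifted = Grid-pushforward (punchIn-injective′ f) (Grid-SameM (SameM-trans I≈P\f (delete≈restrict P f)) G)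
  open NonLoopContraction isMatroid P? f Pf lifted (λ t s → punchInᵢ≢i f _)
  shrink : (∃ λ K → Tight σ₀ K × 2 ^ suc d ≤ ∣ K ∣) → ∃ λ L′ → Grid J L′ (suc a) × 2 ^ suc d ≤ L′
  shrink (K , tight , 2^d+1≤∣K∣) =
    ∣ K ∣ , Grid-SameM J≈restrict (Grid-pullback (punchIn-injective′ f) {M = contracted} G′ λ u s → _ , refl) ,
    2^d+1≤∣K∣
    where
    G′ : Grid contracted ∣ K ∣ (suc a)
    G′ = tight-grid tight (ℕ.≤-trans (2≤2^suc d) 2^d+1≤∣K∣)
    J≈restrict : SameM (restrict contracted (punchIn f)) J
    J≈restrict = SameM-sym (SameM-trans J≈P/f (contract≈restrict {P = P} f Pf))

-- The depth bound

≢⇒2≤n : ∀ {x y : Fin n} → x ≢ y → 2 ≤ n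
≢⇒2≤n {suc zero}    {zero} {zero} x≢y = contradiction refl x≢y
≢⇒2≤n {suc (suc n)}                _   = s≤s (s≤s z≤n)

Grid⇒2≤n : ∀ {M : Indep n} {L a} → Grid M L (suc a) → 2 ≤ L → 2 ≤ n
Grid⇒2≤n G (s≤s (s≤s z≤n)) =
  ≢⇒2≤n λ eq → 0≢1+n (proj₁ (Grid.cell-injective G {zero} {suc zero} {zero} {zero} eq))

depth-bound : ∀ {n M k} → DepthLE n M k → ∀ {L a} → Grid M L a → ∀ d → d ≤ a → 2 ^ d ≤ L → d ≤ k
depth-bound _ _ zero _ _ = z≤n
depth-bound (small _ 1≤k) _ (suc zero) _ _ = 1≤k
depth-bound (small n≤1 _) {a = suc a} G (suc (suc d)) _ 2^d≤L =
  contradiction n≤1 (ℕ.<⇒≱ (Grid⇒2≤n G (ℕ.≤-trans (2≤2^suc (suc d)) 2^d≤L)))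
depth-bound (disc {I = I} {k} _ _ components) G d d≤a 2^d≤L =
  assuming-decidable (d ≤? k) (Pairwise I) λ pairwise? →
    let C , C-component , G′ = Grid-inComponent pairwise? G
    in depth-bound (components C C-component ∣ C ∣ (enumerate C) (enumerate-injective C) (enumerate-range C))
                   G′ d d≤a 2^d≤L
depth-bound (del _ _ _ _) _ (suc zero) _ _ = s≤s z≤n
depth-bound (del _ _ e D) {a = suc a} G (suc (suc d)) (s≤s d+1≤a) 2^d+2≤L =
  s≤s (depth-bound D (Grid-delete G e) (suc d) d+1≤a (ℕ.≤-trans (ℕ.m≤m+n _ _) 2^d+2≤L))
depth-bound (cstar _ _ _ _ _ _) _ (suc zero) _ _ = s≤s z≤n
depth-bound (cstar {k = k} _ _ _ (P , isMatroid , f , I≈P\f , J≈P/f) I≉J D) {a = suc a}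
            G (suc (suc d)) d+2≤a 2^d+2≤L =
  assuming-decidable (suc (suc d) ≤? suc k) P step
  where
  step : Decidable P → suc (suc d) ≤ suc k
  step P? with P? ⁅ f ⁆
  ... | no  ¬Pf =
    contradiction (SameM-trans I≈P\f (SameM-trans (delete≈contract {P = P} ¬Pf) (SameM-sym J≈P/f))) I≉J
  ... | yes Pf  = let _ , G′ , 2^d+1≤L′ = Grid-contract isMatroid P? Pf I≈P\f J≈P/f G d 2^d+2≤L in
                  s≤s (depth-bound D G′ (suc d) (ℕ.≤-trans (ℕ.n≤1+n _) d+2≤a) 2^d+1≤L′)

-- The cycle C_{j,i}

fromℕ⊎inject₁ : ∀ {N} (t : Fin (suc N)) → t ≡ fromℕ N ⊎ ∃ λ t′ → t ≡ inject₁ t′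
fromℕ⊎inject₁ {zero}  zero    = inj₁ refl
fromℕ⊎inject₁ {suc N} zero    = inj₂ (zero , refl)
fromℕ⊎inject₁ {suc N} (suc t) with fromℕ⊎inject₁ t
... | inj₁ t≡top       = inj₁ (cong suc t≡top)
... | inj₂ (t′ , t≡t′) = inj₂ (suc t′ , cong suc t≡t′)

rot-inject₁ : ∀ {N} (t : Fin N) → rot (inject₁ t) ≡ suc t
rot-inject₁ {suc N} zero    = refl
rot-inject₁ {suc N} (suc t) rewrite rot-inject₁ t = refl

rot-fromℕ : ∀ N → rot (fromℕ N) ≡ zero
rot-fromℕ zero    = refl
rot-fromℕ (suc N) rewrite rot-fromℕ N = refl

rot-injective : ∀ {N} → Injective _≡_ _≡_ (rot {N})
rot-injective {N} {x} {y} eq with fromℕ⊎inject₁ x | fromℕ⊎inject₁ y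
... | inj₁ refl       | inj₁ refl       = refl
... | inj₁ refl       | inj₂ (t , refl) with () ← trans (sym (rot-fromℕ N)) (trans eq (rot-inject₁ t))
... | inj₂ (t , refl) | inj₁ refl       with () ← trans (sym (rot-inject₁ t)) (trans eq (rot-fromℕ N))
... | inj₂ (t , refl) | inj₂ (u , refl) =
  cong inject₁ (suc-injective (trans (sym (rot-inject₁ t)) (trans eq (rot-inject₁ u))))

rot-surjective : ∀ {N} (t : Fin (suc N)) → ∃ λ u → rot u ≡ t
rot-surjective {N}     zero    = fromℕ N , rot-fromℕ N
rot-surjective {suc N} (suc t) = inject₁ t , rot-inject₁ t

rot-no-fixpoint : ∀ {N} → 1 ≤ N → (t : Fin (suc N)) → rot t ≢ t
rot-no-fixpoint {suc N} _ t rot-t≡t with fromℕ⊎inject₁ t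
... | inj₁ refl       with () ← trans (sym (rot-fromℕ (suc N))) rot-t≡t
... | inj₂ (u , refl) =
  ℕ.1+n≢n (trans (cong toℕ (sym (rot-inject₁ u))) (trans (cong toℕ rot-t≡t) (toℕ-inject₁ u)))

rot-closed⇒all : ∀ {N} (A : Fin (suc N) → Set) → (∀ t → A t → A (rot t)) → ∀ {u} → A u → ∀ t → A t
rot-closed⇒all {N} A closed {u} Au = <-weakInduction A A-zero step
  where
  step : ∀ t → A (inject₁ t) → A (suc t)
  step t = subst A (rot-inject₁ t) ∘ closed (inject₁ t)
  A-zero : A zero
  A-zero = subst A (rot-fromℕ N) (closed _ (<-weakInduction-startingFrom A Au step (≤fromℕ u)))

module CycleMultigraph (N i : ℕ) where

  j : ℕ
  j = suc (suc N)

  ends : Fin (j * i) → Fin j × Fin j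
  ends = Cji-ends j i

  multiedge : Fin j → Fin i → Fin (j * i)
  multiedge = combine

  row : Fin (j * i) → Fin j
  row e = proj₁ (remQuot i e)

  row-multiedge : ∀ t s → row (multiedge t s) ≡ t
  row-multiedge t s = cong proj₁ (remQuot-combine t s)

  loopless : ∀ {X} (c : CycleIn ends X) → 1 ≤ CycleIn.k c
  loopless record { k = suc _ }            = s≤s z≤n
  loopless record { k = zero ; joins = joins } with joins zero
  ... | inj₁ (a≡v , rot-a≡v) = contradiction (trans rot-a≡v (sym a≡v)) (rot-no-fixpoint (s≤s z≤n) _)
  ... | inj₂ (a≡v , rot-a≡v) = contradiction (trans rot-a≡v (sym a≡v)) (rot-no-fixpoint (s≤s z≤n) _)

  ⊆⁅⁆⇒acyclic : ∀ {D e} → D ⊆ ⁅ e ⁆ → ¬ CycleIn ends D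
  ⊆⁅⁆⇒acyclic D⊆ c@record { k = zero } = contradiction (loopless c) λ ()
  ⊆⁅⁆⇒acyclic D⊆ record { k = suc _ ; edge = edge ; edge-inj = edge-inj ; edge-in = edge-in } =
    0≢1+n (edge-inj (trans (on zero) (sym (on (suc zero)))))
    where
    on : ∀ p → edge p ≡ _
    on p = x∈⁅y⁆⇒x≡y _ (D⊆ (edge-in p))

  pair-circuit : ∀ t {s s′} → s ≢ s′ →
                 Circuit (cycleMatroid ends) (⁅ multiedge t s ⁆ ∪ ⁅ multiedge t s′ ⁆)
  pair-circuit t {s} {s′} s≢s′ = (λ acyclic → acyclic two-cycle) , λ D D⊂ →
    [ ⊆⁅⁆⇒acyclic , ⊆⁅⁆⇒acyclic ]′ (p⊂⁅x⁆∪⁅y⁆⇒p⊆⁅x⁆⊎p⊆⁅y⁆ D⊂)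
    where
    pair : ∀ {A : Set} → A → A → Fin 2 → A
    pair x y zero       = x
    pair x y (suc zero) = y
    pair-injective : ∀ {A : Set} {x y : A} → x ≢ y → Injective _≡_ _≡_ (pair x y)
    pair-injective x≢y {zero}     {zero}     _  = refl
    pair-injective x≢y {zero}     {suc zero} eq = contradiction eq x≢y
    pair-injective x≢y {suc zero} {zero}     eq = contradiction (sym eq) x≢y
    pair-injective x≢y {suc zero} {suc zero} _  = refl
    two-cycle : CycleIn ends (⁅ multiedge t s ⁆ ∪ ⁅ multiedge t s′ ⁆)
    two-cycle = record
      { k        = 1
      ; edge     = pair (multiedge t s) (multiedge t s′)
      ; vert     = pair t (rot t)
      ; edge-inj = pair-injective (s≢s′ ∘ proj₂ ∘ combine-injective t s t s′)
      ; vert-inj = pair-injective (rot-no-fixpoint (s≤s z≤n) t ∘ sym)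
      ; edge-in  = λ { zero → x∈p∪q⁺ (inj₁ (x∈⁅x⁆ _)) ; (suc zero) → x∈p∪q⁺ (inj₂ (x∈⁅x⁆ _)) }
      ; joins    = λ { zero       → inj₁ (row-multiedge t s , cong rot (row-multiedge t s))
                     ; (suc zero) → inj₂ (row-multiedge t s′ , cong rot (row-multiedge t s′)) }
      }

  hamilton-cycle : ∀ σ → CycleIn ends (transversal multiedge σ ⊤)
  hamilton-cycle σ = record
    { k        = suc N
    ; edge     = λ t → multiedge t (σ t)
    ; vert     = id
    ; edge-inj = λ eq → proj₁ (combine-injective _ _ _ _ eq)
    ; vert-inj = id
    ; edge-in  = λ t → x∈image⁺ (λ t → multiedge t (σ t)) (∈⊤ {x = t}) refl
    ; joins    = λ t → inj₁ (row-multiedge t (σ t) , cong rot (row-multiedge t (σ t)))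
    }

  module CycleInTransversal (σ : Fin j → Fin i) {D} (D⊆T : D ⊆ transversal multiedge σ ⊤)
                            (c : CycleIn ends D) where
    open CycleIn c

    r : Fin (suc k) → Fin j
    r p = row (edge p)

    edge≡ : ∀ p → edge p ≡ multiedge (r p) (σ (r p))
    edge≡ p = let t , _ , multiedge≡edge = x∈image⁻ (λ t → multiedge t (σ t)) ⊤ (D⊆T (edge-in p)) in
      trans (sym multiedge≡edge) (cong (λ u → multiedge u (σ u)) (trans (sym (row-multiedge t (σ t))) (cong row multiedge≡edge)))

    same-row : ∀ {p q} → r p ≡ r q → p ≡ q
    same-row {p} {q} rp≡rq = edge-inj (trans (edge≡ p) (trans (cong (λ u → multiedge u (σ u)) rp≡rq) (sym (edge≡ q))))

    -- The neighbouring edge of the cycle at the vertex rot u lies in row rot u: otherwise it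
    -- would be the edge of the transversal in row u again.
    rows-rot-closed : ∀ u → (∃ λ p → r p ≡ u) → ∃ λ p → r p ≡ rot u
    rows-rot-closed _ (p , refl) with joins p
    ... | inj₁ (_ , rot-rp≡v-rot-p) with joins (rot p)
    ...   | inj₁ (r-rot-p≡v-rot-p , _) = rot p , trans r-rot-p≡v-rot-p (sym rot-rp≡v-rot-p)
    ...   | inj₂ (_ , rot-r-rot-p≡v-rot-p) =
      contradiction (same-row (rot-injective (trans rot-r-rot-p≡v-rot-p (sym rot-rp≡v-rot-p)))) (rot-no-fixpoint (loopless c) p)
    rows-rot-closed _ (p , refl) | inj₂ (_ , rot-rp≡vp) with rot-surjective p
    ... | q , refl with joins q
    ...   | inj₁ (_ , rot-rq≡v-rot-q) =
      contradiction (sym (same-row (rot-injective (trans rot-rq≡v-rot-q (sym rot-rp≡vp))))) (rot-no-fixpoint (loopless c) q)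
    ...   | inj₂ (rq≡v-rot-q , _) = q , trans rq≡v-rot-q (sym rot-rp≡vp)

    every-row : ∀ t → ∃ λ p → r p ≡ t
    every-row = rot-closed⇒all _ rows-rot-closed (zero , refl)

  transversal-circuit : ∀ σ → Circuit (cycleMatroid ends) (transversal multiedge σ ⊤)
  transversal-circuit σ = (λ acyclic → acyclic (hamilton-cycle σ)) , λ D (D⊆T , y , y∈T , y∉D) c →
    let open CycleInTransversal σ D⊆T c
        t , _ , multiedge≡y = x∈image⁻ (λ t → multiedge t (σ t)) ⊤ y∈T
        p , rp≡t = every-row t
    in y∉D (subst (_∈ D) (trans (edge≡ p) (trans (cong (λ u → multiedge u (σ u)) rp≡t) multiedge≡y)) (CycleIn.edge-in c p))

  cycle-grid : Grid (cycleMatroid ends) j i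
  cycle-grid = record
    { cell                = multiedge
    ; cell-injective      = combine-injective _ _ _ _
    ; row-circuit         = pair-circuit
    ; transversal-circuit = transversal-circuit
    }

mainTheorem7 : (i : ℕ) → 1 ≤ i → (j : ℕ) → 2 ^ i ≤ j →
    ∀ k → DepthLE (j * i) (cycleMatroid (Cji-ends j i)) k → i ≤ k
mainTheorem7 (suc i) _ 0             2^i≤0 _ _ = contradiction 2^i≤0 (ℕ.<⇒≱ (ℕ.m^n>0 2 (suc i)))
mainTheorem7 (suc i) _ 1             2^i≤1 _ _ = contradiction (ℕ.≤-trans (2≤2^suc i) 2^i≤1) λ { (s≤s ()) }
mainTheorem7 (suc i) _ (suc (suc N)) 2^i≤j k D =
  depth-bound D (CycleMultigraph.cycle-grid N (suc i)) (suc i) ℕ.≤-refl 2^i≤j
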